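{- A game is weakly miserable if and only if it is domestic.
   Context: A game is a two-player impartial game given by a directed acyclic graph whose vertices are positions and whose arcs are moves, such that from every position only finitely many positions are reachable. A position with no moves is terminal. $\operatorname{mex}(S)$ is the least non-negative integer not in $S$. The normal Sprague–Grundy function is $\mathcal{G}(x)=\operatorname{mex}\{\mathcal{G}(y): x\to y\}$ (so $0$ on terminal positions); the misère Sprague–Grundy function $\mathcal{G}^-$ satisfies $\mathcal{G}^-(x)=1$ for terminal $x$ and $\mathcal{G}^-(x)=\operatorname{mex}\{\mathcal{G}^-(y): x\to y\}$ otherwise. An $(i,j)$-position is a position $x$ with $\mathcal{G}(x)=i$, $\mathcal{G}^-(x)=j$; $V_{i,j}$ denotes the set of $(i,j)$-positions. A position $x$ is movable to a set $W$ if there is a move from $x$ to some position of $W$. A game is domestic if it has no $(0,k)$-position and no $(k,0)$-position with $k\ge 2$. A game is weakly miserable if every position $x$ satisfies at least one of: (a) $x\in V_{0,1}\cup V_{1,0}$; (b) $x$ is not movable to $V_{0,1}\cup V_{1,0}$; (c) $x$ is movable to $V_{0,1}$ and to $V_{1,0}$; (c$_0$) $x$ is movable to $V_{0,1}$ and to $V_{0,0}$; (c$_1$) $x$ is movable to $V_{1,0}$ and to $V_{0,0}$. -}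

module Defs where

open import Data.Nat using (ℕ; zero; suc; _≥_)
open import Data.Nat.Properties using (_≟_)
open import Data.List using (List; []; _∷_; length)
open import Data.List.Relation.Unary.Any using (Any; here; there)
open import Data.List.Membership.Propositional using (_∈_)
open import Data.List.Membership.DecPropositional _≟_ using (_∈?_)
open import Data.Product using (_×_; ∃; _,_)
open import Data.Sum using (_⊎_)
open import Relation.Nullary using (¬_; yes; no)
open import Relation.Binary.PropositionalEquality using (_≡_; refl)
open import Induction.WellFounded using (WellFounded; Acc; acc)

-- mex(S): least natural number not in the finite list S.
-- mexFrom fuel S n tests n, n+1, ... in turn; fuel = length S suffices
-- (by pigeonhole some value in 0..length S is missing from S).

mexFrom : ℕ → List ℕ → ℕ → ℕ
mexFrom zero    S n = n
mexFrom (suc f) S n with n ∈? S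
... | yes _ = mexFrom f S (suc n)
... | no  _ = n

mex : List ℕ → ℕ
mex S = mexFrom (length S) S 0

mapMem : {A : Set} (ys : List A) → ((y : A) → y ∈ ys → ℕ) → List ℕ
mapMem []       f = []
mapMem (y ∷ ys) f = f y (here refl) ∷ mapMem ys (λ z z∈ → f z (there z∈))

-- A game: a type of positions, each with a finite list of options
-- (the moves), such that the move relation is well-founded (so the
-- graph is acyclic; together with finite branching, only finitely
-- many positions are reachable from any position).

record Game : Set₁ where
  field
    Pos   : Set
    moves : Pos → List Pos
    wf    : WellFounded (λ y x → y ∈ moves x)

module _ (g : Game) where
  open Game g

  Move : Pos → Pos → Set
  Move x y = y ∈ moves x

  Gacc : (x : Pos) → Acc (λ y x → y ∈ moves x) x → ℕ
  Gacc x (acc rs) = mex (mapMem (moves x) (λ y y∈ → Gacc y (rs y∈)))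

  G : Pos → ℕ
  G x = Gacc x (wf x)

  -- misère Sprague–Grundy value: G⁻(x) = 1 if x is terminal,
  -- G⁻(x) = mex { G⁻(y) : x → y } otherwise.
  -- (mapMem preserves length, so the list of option values is empty
  -- exactly when x has no moves.)
  misMex : List ℕ → ℕ
  misMex []       = 1
  misMex (a ∷ as) = mex (a ∷ as)

  G⁻acc : (x : Pos) → Acc (λ y x → y ∈ moves x) x → ℕ
  G⁻acc x (acc rs) = misMex (mapMem (moves x) (λ y y∈ → G⁻acc y (rs y∈)))

  G⁻ : Pos → ℕ
  G⁻ x = G⁻acc x (wf x)

  V : ℕ → ℕ → Pos → Set
  V i j x = G x ≡ i × G⁻ x ≡ j

  MovableTo : Pos → (Pos → Set) → Set
  MovableTo x W = ∃ λ y → Move x y × W y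

  V01∪V10 : Pos → Set
  V01∪V10 y = V 0 1 y ⊎ V 1 0 y

  Domestic : Set
  Domestic = ∀ (x : Pos) (k : ℕ) → k ≥ 2 → ¬ V 0 k x × ¬ V k 0 x

  WeaklyMiserable : Set
  WeaklyMiserable = ∀ (x : Pos) →
      V01∪V10 x
    ⊎ ¬ MovableTo x V01∪V10
    ⊎ (MovableTo x (V 0 1) × MovableTo x (V 1 0))         -- (c)
    ⊎ (MovableTo x (V 0 1) × MovableTo x (V 0 0))         -- (c₀)
    ⊎ (MovableTo x (V 1 0) × MovableTo x (V 0 0))         -- (c₁)

-- Both G and G⁻ obey the mex rules at every position with a move: the value is 0
-- exactly when no option has value 0, and a value ≥ 2 forces an option of value 0.
-- If x is a (0,k)-position with k ≥ 2 in a game whose options are domestic, an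
-- option of misère value 0 must be a (1,0)-position, so x is movable to V₀₁ ∪ V₁₀
-- without lying in it; each of (c), (c₀), (c₁) then supplies an option of normal
-- value 0, contradicting G(x) = 0.  Conversely, in a domestic game a position
-- movable to V₀₁ but not to V₁₀ (and not in V₁₀) either has an option of misère
-- value 0, necessarily a (0,0)-position, or has misère value 0 itself and would be
-- a (1,0)-position.  Swapping the roles of G and G⁻ handles the other halves.
module Submission where

open import Defs
open import Data.Nat using (ℕ; zero; suc; _≤_; _<_; z≤n; s≤s)
open import Data.Nat.Properties using (_≟_; ≤-refl; ≤-reflexive; ≤-trans; n≤1+n; <⇒≱; ≤∧≢⇒<; ≮⇒≥)
open import Data.List using (List; []; _∷_; length; map)
open import Data.List.Relation.Unary.Any using (here; there; any?)
open import Data.List.Membership.Propositional using (_∈_; _∉_; find; lose)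
open import Data.List.Membership.Propositional.Properties using (∈-map⁺; ∈-map⁻)
open import Data.List.Membership.DecPropositional _≟_ using (_∈?_)
open import Data.Product using (_×_; ∃; _,_; proj₁; proj₂; swap)
open import Data.Sum using (_⊎_; inj₁; inj₂)
open import Function using (_∘_)
open import Relation.Nullary using (¬_; Dec; yes; no; contradiction)
open import Relation.Nullary.Decidable using (map′; _×-dec_; _⊎-dec_)
open import Relation.Binary.PropositionalEquality using (_≡_; _≢_; refl; sym; trans; cong; cong₂; subst)
open import Induction.WellFounded using (Acc; acc; WfRec; module All)

≤1⇒≡0⊎≡1 : ∀ {m} → m ≤ 1 → m ≡ 0 ⊎ m ≡ 1
≤1⇒≡0⊎≡1 z≤n       = inj₁ refl
≤1⇒≡0⊎≡1 (s≤s z≤n) = inj₂ refl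

mexFrom-≥ : ∀ fuel S n → n ≤ mexFrom fuel S n
mexFrom-≥ zero       S n = ≤-refl
mexFrom-≥ (suc fuel) S n with n ∈? S
... | yes _ = ≤-trans (n≤1+n n) (mexFrom-≥ fuel S (suc n))
... | no  _ = ≤-refl

mexFrom-<⇒∈ : ∀ fuel S n {m} → n ≤ m → m < mexFrom fuel S n → m ∈ S
mexFrom-<⇒∈ zero       S n n≤m m< = contradiction n≤m (<⇒≱ m<)
mexFrom-<⇒∈ (suc fuel) S n {m} n≤m m< with n ∈? S
... | no  _ = contradiction n≤m (<⇒≱ m<)
... | yes n∈S with n ≟ m
...   | yes refl = n∈S
...   | no  n≢m  = mexFrom-<⇒∈ fuel S (suc n) (≤∧≢⇒< n≤m n≢m) m<

<mex⇒∈ : ∀ S {m} → m < mex S → m ∈ S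
<mex⇒∈ S = mexFrom-<⇒∈ (length S) S 0 z≤n

0∈⇒mex≢0 : ∀ S → 0 ∈ S → mex S ≢ 0
0∈⇒mex≢0 (a ∷ as) 0∈S mex≡0 with 0 ∈? (a ∷ as)
... | no  0∉S = 0∉S 0∈S
... | yes _ with subst (1 ≤_) mex≡0 (mexFrom-≥ (length as) (a ∷ as) 1)
...   | ()

0∉⇒mex≡0 : ∀ S → 0 ∉ S → mex S ≡ 0
0∉⇒mex≡0 []       _   = refl
0∉⇒mex≡0 (a ∷ as) 0∉S with 0 ∈? (a ∷ as)
... | yes 0∈S = contradiction 0∈S 0∉S
... | no  _   = refl

mapMem-cong : {A : Set} (ys : List A) {f f′ : (y : A) → y ∈ ys → ℕ} →
              (∀ y y∈ → f y y∈ ≡ f′ y y∈) → mapMem ys f ≡ mapMem ys f′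
mapMem-cong []       f≗f′ = refl
mapMem-cong (y ∷ ys) f≗f′ = cong₂ _∷_ (f≗f′ y (here refl)) (mapMem-cong ys (λ z z∈ → f≗f′ z (there z∈)))

mapMem-const : {A : Set} (ys : List A) (h : A → ℕ) → mapMem ys (λ y _ → h y) ≡ map h ys
mapMem-const []       h = refl
mapMem-const (y ∷ ys) h = cong (h y ∷_) (mapMem-const ys h)

misMex-∈ : ∀ g {S : List ℕ} {a} → a ∈ S → misMex g S ≡ mex S
misMex-∈ g {_ ∷ _} _ = refl

module _ (g : Game) where
  open Game g

  _⊏_ : Pos → Pos → Set
  y ⊏ x = y ∈ moves x

  terminal-or-option : ∀ x → moves x ≡ [] ⊎ ∃ (_⊏ x)
  terminal-or-option x with moves x
  ... | []    = inj₁ refl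
  ... | y ∷ _ = inj₂ (y , here refl)

  movableTo? : {P : Pos → Set} → (∀ y → Dec (P y)) → ∀ x → Dec (MovableTo g x P)
  movableTo? P? x = map′ find (λ (_ , y⊏x , Py) → lose y⊏x Py) (any? P? (moves x))

  movableTo-map : ∀ {x} {P Q : Pos → Set} → (∀ {y} → P y → Q y) → MovableTo g x P → MovableTo g x Q
  movableTo-map P⇒Q (y , y⊏x , Py) = y , y⊏x , P⇒Q Py

  -- A recursion on Acc through mapMem does not depend on the accessibility proof,
  -- so it unfolds to an ordinary map over the options.
  unfold-accRec : (φ : List ℕ → ℕ) (F : ∀ x → Acc _⊏_ x → ℕ) →
                  (∀ {x} (rs : WfRec _⊏_ (Acc _⊏_) x) →
                     F x (acc rs) ≡ φ (mapMem (moves x) (λ y y⊏x → F y (rs y⊏x)))) →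
                  ∀ x → F x (wf x) ≡ φ (map (λ y → F y (wf y)) (moves x))
  unfold-accRec φ F F-acc x with wf x
  ... | acc rs = trans (F-acc rs) (cong φ (trans (mapMem-cong (moves x) (λ y _ → irrelevant y _ (wf y)))
                                                 (mapMem-const (moves x) (λ y → F y (wf y)))))
    where
    irrelevant : ∀ y (a b : Acc _⊏_ y) → F y a ≡ F y b
    irrelevant y (acc rs) (acc rs′) =
      trans (F-acc rs) (trans (cong φ (mapMem-cong (moves y) (λ z z⊏y → irrelevant z (rs z⊏y) (rs′ z⊏y))))
                              (sym (F-acc rs′)))

  G-unfold : ∀ x → G g x ≡ mex (map (G g) (moves x))
  G-unfold = unfold-accRec mex (Gacc g) (λ _ → refl)

  G⁻-unfold : ∀ x → G⁻ g x ≡ misMex g (map (G⁻ g) (moves x))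
  G⁻-unfold = unfold-accRec (misMex g) (G⁻acc g) (λ _ → refl)

  record IsGrundyLike (f : Pos → ℕ) : Set where
    field
      mex-options : ∀ {x y} → y ⊏ x → f x ≡ mex (map f (moves x))
      terminal≤1  : ∀ {x} → moves x ≡ [] → f x ≤ 1

    zero-option⇒≢0 : ∀ {x y} → y ⊏ x → f y ≡ 0 → f x ≢ 0
    zero-option⇒≢0 {x} y⊏x fy≡0 fx≡0 =
      0∈⇒mex≢0 _ (subst (_∈ map f (moves x)) fy≡0 (∈-map⁺ f y⊏x)) (trans (sym (mex-options y⊏x)) fx≡0)

    no-zero-option⇒≡0 : ∀ {x y} → y ⊏ x → (∀ {z} → z ⊏ x → f z ≢ 0) → f x ≡ 0
    no-zero-option⇒≡0 y⊏x none =
      trans (mex-options y⊏x) (0∉⇒mex≡0 _ λ 0∈ → let z , z⊏x , 0≡fz = ∈-map⁻ f 0∈ in none z⊏x (sym 0≡fz))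

    ≥2⇒zero-option : ∀ {x} → 2 ≤ f x → MovableTo g x (λ z → f z ≡ 0)
    ≥2⇒zero-option {x} 2≤fx with terminal-or-option x
    ... | inj₁ terminal = contradiction (terminal≤1 terminal) (<⇒≱ 2≤fx)
    ... | inj₂ (y , y⊏x) =
      let z , z⊏x , 0≡fz = ∈-map⁻ f (<mex⇒∈ _ (subst (0 <_) (mex-options y⊏x) (≤-trans (s≤s z≤n) 2≤fx)))
      in z , z⊏x , sym 0≡fz

  G-isGrundyLike : IsGrundyLike (G g)
  G-isGrundyLike = record
    { mex-options = λ {x} _ → G-unfold x
    ; terminal≤1  = λ {x} t → ≤-trans (≤-reflexive (trans (G-unfold x) (cong (mex ∘ map (G g)) t))) z≤n
    }

  G⁻-isGrundyLike : IsGrundyLike (G⁻ g)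
  G⁻-isGrundyLike = record
    { mex-options = λ {x} y⊏x → trans (G⁻-unfold x) (misMex-∈ g (∈-map⁺ (G⁻ g) y⊏x))
    ; terminal≤1  = λ {x} t → ≤-reflexive (trans (G⁻-unfold x) (cong (misMex g ∘ map (G⁻ g)) t))
    }

  -- Valued G G⁻ i j is V g i j and Valued G⁻ G i j is its transpose V g j i, so each
  -- lemma below about a pair (f , h) serves both halves of the theorem.
  Valued : (f h : Pos → ℕ) → ℕ → ℕ → Pos → Set
  Valued f h i j y = f y ≡ i × h y ≡ j

  module _ {f h : Pos → ℕ} (F : IsGrundyLike f) (H : IsGrundyLike h) where
    private
      module F = IsGrundyLike F
      module H = IsGrundyLike H

    option-valued-1-0 : ∀ {x} → (∀ {y} → y ⊏ x → h y ≡ 0 → f y ≤ 1) →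
                        f x ≡ 0 → 2 ≤ h x → MovableTo g x (Valued f h 1 0)
    option-valued-1-0 bounded fx≡0 2≤hx with H.≥2⇒zero-option 2≤hx
    ... | y , y⊏x , hy≡0 with ≤1⇒≡0⊎≡1 (bounded y⊏x hy≡0)
    ...   | inj₁ fy≡0 = contradiction fx≡0 (F.zero-option⇒≢0 y⊏x fy≡0)
    ...   | inj₂ fy≡1 = y , y⊏x , fy≡1 , hy≡0

    no-h-zero-option⇒valued-1-0 : (∀ y → h y ≡ 0 → f y ≤ 1) → ∀ {x y} → y ⊏ x → f y ≡ 0 →
                                  ¬ MovableTo g x (λ z → h z ≡ 0) → Valued f h 1 0 x
    no-h-zero-option⇒valued-1-0 bounded {x} y⊏x fy≡0 ¬to-h0 = classify (≤1⇒≡0⊎≡1 (bounded x hx≡0))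
      where
      hx≡0 : h x ≡ 0
      hx≡0 = H.no-zero-option⇒≡0 y⊏x (λ z⊏x hz≡0 → ¬to-h0 (_ , z⊏x , hz≡0))

      classify : f x ≡ 0 ⊎ f x ≡ 1 → Valued f h 1 0 x
      classify (inj₁ fx≡0) = contradiction fx≡0 (F.zero-option⇒≢0 y⊏x fy≡0)
      classify (inj₂ fx≡1) = fx≡1 , hx≡0

    option-valued-0-0 : (∀ y → h y ≡ 0 → f y ≤ 1) → ∀ {x} →
                        MovableTo g x (Valued f h 0 1) → ¬ MovableTo g x (Valued f h 1 0) →
                        ¬ Valued f h 1 0 x → MovableTo g x (Valued f h 0 0)
    option-valued-0-0 bounded {x} (y , y⊏x , fy≡0 , _) ¬to10 ¬x10 with movableTo? (λ z → h z ≟ 0) x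
    ... | no ¬to-h0 = contradiction (no-h-zero-option⇒valued-1-0 bounded y⊏x fy≡0 ¬to-h0) ¬x10
    ... | yes (z , z⊏x , hz≡0) with ≤1⇒≡0⊎≡1 (bounded z hz≡0)
    ...   | inj₁ fz≡0 = z , z⊏x , fz≡0 , hz≡0
    ...   | inj₂ fz≡1 = contradiction (z , z⊏x , fz≡1 , hz≡0) ¬to10

  private
    module G-rules  = IsGrundyLike G-isGrundyLike
    module G⁻-rules = IsGrundyLike G⁻-isGrundyLike

  DomesticAt : Pos → Set
  DomesticAt x = (G⁻ g x ≡ 0 → G g x ≤ 1) × (G g x ≡ 0 → G⁻ g x ≤ 1)

  domestic⇒domesticAt : Domestic g → ∀ x → DomesticAt x
  domestic⇒domesticAt dom x =
    (λ G⁻x≡0 → ≮⇒≥ λ 2≤Gx → proj₂ (dom x _ 2≤Gx) (refl , G⁻x≡0)) ,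
    (λ Gx≡0 → ≮⇒≥ λ 2≤G⁻x → proj₁ (dom x _ 2≤G⁻x) (Gx≡0 , refl))

  domesticAt⇒domestic : (∀ x → DomesticAt x) → Domestic g
  domesticAt⇒domestic domAt x k 2≤k =
    (λ (Gx≡0 , G⁻x≡k) → <⇒≱ 2≤k (subst (_≤ 1) G⁻x≡k (proj₂ (domAt x) Gx≡0))) ,
    (λ (Gx≡k , G⁻x≡0) → <⇒≱ 2≤k (subst (_≤ 1) Gx≡k (proj₁ (domAt x) G⁻x≡0)))

  WeaklyMiserableAt : Pos → Set
  WeaklyMiserableAt x =
      V01∪V10 g x
    ⊎ ¬ MovableTo g x (V01∪V10 g)
    ⊎ (MovableTo g x (V g 0 1) × MovableTo g x (V g 1 0))
    ⊎ (MovableTo g x (V g 0 1) × MovableTo g x (V g 0 0))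
    ⊎ (MovableTo g x (V g 1 0) × MovableTo g x (V g 0 0))

  V01∪V10⇒≤1 : ∀ {x} → V01∪V10 g x → G g x ≤ 1 × G⁻ g x ≤ 1
  V01∪V10⇒≤1 (inj₁ (Gx≡0 , G⁻x≡1)) = ≤-trans (≤-reflexive Gx≡0) z≤n , ≤-reflexive G⁻x≡1
  V01∪V10⇒≤1 (inj₂ (Gx≡1 , G⁻x≡0)) = ≤-reflexive Gx≡1 , ≤-trans (≤-reflexive G⁻x≡0) z≤n

  weaklyMiserableAt⇒zero-options : ∀ {x} → WeaklyMiserableAt x → ¬ V01∪V10 g x → MovableTo g x (V01∪V10 g) →
                                    MovableTo g x (λ y → G g y ≡ 0) × MovableTo g x (λ y → G⁻ g y ≡ 0)
  weaklyMiserableAt⇒zero-options (inj₁ x∈) ¬x∈ _ = contradiction x∈ ¬x∈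
  weaklyMiserableAt⇒zero-options (inj₂ (inj₁ ¬to)) _ to = contradiction to ¬to
  weaklyMiserableAt⇒zero-options (inj₂ (inj₂ (inj₁ (to01 , to10)))) _ _ =
    movableTo-map proj₁ to01 , movableTo-map proj₂ to10
  weaklyMiserableAt⇒zero-options (inj₂ (inj₂ (inj₂ (inj₁ (to01 , to00))))) _ _ =
    movableTo-map proj₁ to01 , movableTo-map proj₂ to00
  weaklyMiserableAt⇒zero-options (inj₂ (inj₂ (inj₂ (inj₂ (to10 , to00))))) _ _ =
    movableTo-map proj₁ to00 , movableTo-map proj₂ to10

  domesticAt-step : ∀ {x} → WeaklyMiserableAt x → (∀ {y} → y ⊏ x → DomesticAt y) → DomesticAt x
  domesticAt-step {x} wm domAt-options = bound-G , bound-G⁻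
    where
    zero-options : ∀ {y} → y ⊏ x → V01∪V10 g y → ¬ V01∪V10 g x →
                   MovableTo g x (λ y → G g y ≡ 0) × MovableTo g x (λ y → G⁻ g y ≡ 0)
    zero-options y⊏x y∈ ¬x∈ = weaklyMiserableAt⇒zero-options wm ¬x∈ (_ , y⊏x , y∈)

    bound-G : G⁻ g x ≡ 0 → G g x ≤ 1
    bound-G G⁻x≡0 = ≮⇒≥ λ 2≤Gx →
      let y , y⊏x , G⁻y≡1 , Gy≡0 = option-valued-1-0 G⁻-isGrundyLike G-isGrundyLike
                                     (λ y⊏x → proj₂ (domAt-options y⊏x)) G⁻x≡0 2≤Gx
          z , z⊏x , G⁻z≡0 = proj₂ (zero-options y⊏x (inj₁ (Gy≡0 , G⁻y≡1))
                                     (λ x∈ → <⇒≱ 2≤Gx (proj₁ (V01∪V10⇒≤1 x∈))))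
      in G⁻-rules.zero-option⇒≢0 z⊏x G⁻z≡0 G⁻x≡0

    bound-G⁻ : G g x ≡ 0 → G⁻ g x ≤ 1
    bound-G⁻ Gx≡0 = ≮⇒≥ λ 2≤G⁻x →
      let y , y⊏x , Gy≡1 , G⁻y≡0 = option-valued-1-0 G-isGrundyLike G⁻-isGrundyLike
                                     (λ y⊏x → proj₁ (domAt-options y⊏x)) Gx≡0 2≤G⁻x
          z , z⊏x , Gz≡0 = proj₁ (zero-options y⊏x (inj₂ (Gy≡1 , G⁻y≡0))
                                    (λ x∈ → <⇒≱ 2≤G⁻x (proj₂ (V01∪V10⇒≤1 x∈))))
      in G-rules.zero-option⇒≢0 z⊏x Gz≡0 Gx≡0

  weaklyMiserable⇒domesticAt : WeaklyMiserable g → ∀ x → DomesticAt x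
  weaklyMiserable⇒domesticAt wm = All.wfRec wf _ DomesticAt (λ x → domesticAt-step (wm x))

  V? : ∀ i j y → Dec (V g i j y)
  V? i j y = (G g y ≟ i) ×-dec (G⁻ g y ≟ j)

  domesticAt⇒weaklyMiserableAt : (∀ x → DomesticAt x) → ∀ x → WeaklyMiserableAt x
  domesticAt⇒weaklyMiserableAt domAt x
    with V? 0 1 x ⊎-dec V? 1 0 x | movableTo? (V? 0 1) x | movableTo? (V? 1 0) x
  ... | yes x∈ | _ | _ = inj₁ x∈
  ... | no ¬x∈ | yes to01 | yes to10 = inj₂ (inj₂ (inj₁ (to01 , to10)))
  ... | no ¬x∈ | no ¬to01 | no ¬to10 =
    inj₂ (inj₁ λ { (y , y⊏x , inj₁ y∈) → ¬to01 (y , y⊏x , y∈) ; (y , y⊏x , inj₂ y∈) → ¬to10 (y , y⊏x , y∈) })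
  ... | no ¬x∈ | yes to01 | no ¬to10 = inj₂ (inj₂ (inj₂ (inj₁ (to01 ,
    option-valued-0-0 G-isGrundyLike G⁻-isGrundyLike (proj₁ ∘ domAt) to01 ¬to10 (¬x∈ ∘ inj₂)))))
  ... | no ¬x∈ | no ¬to01 | yes to10 = inj₂ (inj₂ (inj₂ (inj₂ (to10 , movableTo-map swap
    (option-valued-0-0 G⁻-isGrundyLike G-isGrundyLike (proj₂ ∘ domAt)
      (movableTo-map swap to10) (¬to01 ∘ movableTo-map swap) (¬x∈ ∘ inj₁ ∘ swap))))))

theorem3p2 : (g : Game) → (WeaklyMiserable g → Domestic g) × (Domestic g → WeaklyMiserable g)
theorem3p2 g = domesticAt⇒domestic g ∘ weaklyMiserable⇒domesticAt g ,
               domesticAt⇒weaklyMiserableAt g ∘ domestic⇒domesticAt g
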